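{- Let $\lambda\in\mathbb{C}$ and let $n,j$ be integers with $n\ge0$ and $j\ge1$. Then \[ {n+1 \brack j}_\lambda=\sum_{k=j-1}^n{n \brack k}_\lambda\binom{k}{j-1}\lambda^{k+1-j}={n \brack j-1}_\lambda+\sum_{k=j}^n{n \brack k}_\lambda\binom{k}{j-1}\lambda^{k+1-j}. \]
   Context: For $\lambda\in\mathbb{C}$, the $\lambda$-rising factorial is $\langle x\rangle_{0,\lambda}=1$, $\langle x\rangle_{n,\lambda}=x(x+\lambda)\cdots(x+(n-1)\lambda)$ for $n\ge1$. The unsigned $\lambda$-Stirling numbers of the first kind are defined by $\langle x\rangle_{n,\lambda}=\sum_{k=0}^n {n \brack k}_\lambda x^k$, with the convention ${n \brack k}_\lambda=0$ for $k>n$ or $k<0$. -}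

module Defs where

open import Level using (Level)
open import Algebra.Bundles using (CommutativeRing)
open import Data.Nat using (ℕ; zero; suc; _≤?_; _∸_) renaming (_+_ to _+ℕ_)
open import Data.List using (List; []; _∷_; map)
open import Data.Bool using (if_then_else_)
open import Relation.Nullary using (does)

-- Everything is parametrised by a commutative ring R (the paper uses R = ℂ).
module _ {c ℓ : Level} (R : CommutativeRing c ℓ) where
  open CommutativeRing R hiding (zero)

  fromℕ : ℕ → Carrier
  fromℕ zero = 0#
  fromℕ (suc n) = 1# + fromℕ n

  pow : Carrier → ℕ → Carrier
  pow a zero = 1#
  pow a (suc n) = a * pow a n

  -- polynomials over R as coefficient lists (constant term first)
  addP : List Carrier → List Carrier → List Carrier
  addP [] q = q
  addP (a ∷ p) [] = a ∷ p
  addP (a ∷ p) (b ∷ q) = (a + b) ∷ addP p q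

  mulP : List Carrier → List Carrier → List Carrier
  mulP [] q = []
  mulP (a ∷ p) q = addP (map (a *_) q) (0# ∷ mulP p q)

  coeff : List Carrier → ℕ → Carrier
  coeff [] k = 0#
  coeff (a ∷ p) zero = a
  coeff (a ∷ p) (suc k) = coeff p k

  -- the λ-rising factorial <x>_{n,λ} = x (x+λ) ... (x+(n-1)λ) as a polynomial in x
  risingFact : Carrier → ℕ → List Carrier
  risingFact lam zero = 1# ∷ []
  risingFact lam (suc n) = mulP (risingFact lam n) ((fromℕ n * lam) ∷ 1# ∷ [])

  -- unsigned λ-Stirling numbers of the first kind: coefficient of x^k in <x>_{n,λ}
  -- (automatically 0 for k > n)
  stirling1 : Carrier → ℕ → ℕ → Carrier
  stirling1 lam n k = coeff (risingFact lam n) k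

  sumTo : ℕ → (ℕ → Carrier) → Carrier
  sumTo zero f = f zero
  sumTo (suc m) f = sumTo m f + f (suc m)

  sumFromTo : ℕ → ℕ → (ℕ → Carrier) → Carrier
  sumFromTo a b f = if does (a ≤? b) then sumTo (b ∸ a) (λ i → f (a +ℕ i)) else 0#

-- Since ⟨x⟩_{n+1,λ} = x ⟨x + λ⟩_{n,λ}, expanding ⟨x + λ⟩_{n,λ} = Σ_k [n,k]_λ (x + λ)^k
-- binomially shows that [n+1,j+1]_λ is the coefficient Σ_k [n,k]_λ C(k,j) λ^{k-j} of x^j
-- in ⟨x + λ⟩_{n,λ}.  Rather than composing polynomials, we check that these coefficients
-- satisfy the recurrence [n+1,j]_λ = [n,j]_λ · nλ + [n,j-1]_λ of the Stirling numbers.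
{-# OPTIONS --safe #-}
module Submission where

open import Defs
open import Level using (Level)
open import Algebra.Bundles using (CommutativeRing)
open import Data.Nat using (ℕ; zero; suc; _≤_; _<_; _∸_; _≤?_; _<?_; z≤n; s≤s)
  renaming (_+_ to _+ℕ_)
import Data.Nat.Properties as ℕ
open import Data.Nat.Combinatorics using (_C_; k>n⇒nCk≡0; nCn≡1; nCk+nC[k+1]≡[n+1]C[k+1])
open import Data.List using ([]; _∷_)
open import Data.Product using (_×_; _,_)
open import Relation.Nullary using (yes; no)
open import Relation.Nullary.Decidable using (dec-true; dec-false)
open import Relation.Binary.Definitions using (tri<; tri≈; tri>)
open import Data.Bool using (if_then_else_)
open import Relation.Binary.PropositionalEquality as ≡ using (_≡_)
import Algebra.Properties.CommutativeSemigroup as CommutativeSemigroupProperties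
import Algebra.Solver.Ring.NaturalCoefficients.Default as NaturalCoefficientsSolver
import Relation.Binary.Reasoning.Setoid as SetoidReasoning

module _ {c ℓ : Level} (R : CommutativeRing c ℓ) where
  open CommutativeRing R hiding (zero)
  open CommutativeSemigroupProperties *-commutativeSemigroup using (x∙yz≈y∙xz)
  open CommutativeSemigroupProperties +-commutativeSemigroup using () renaming (interchange to +-interchange)
  open NaturalCoefficientsSolver commutativeSemiring using (solve; _:=_; _:+_; _:*_)
  open SetoidReasoning setoid

  shift : (ℕ → Carrier) → ℕ → Carrier
  shift f zero = 0#
  shift f (suc k) = f k

  fromℕ-+ : ∀ m n → fromℕ R (m +ℕ n) ≈ fromℕ R m + fromℕ R n
  fromℕ-+ zero n = sym (+-identityˡ _)
  fromℕ-+ (suc m) n = trans (+-congˡ (fromℕ-+ m n)) (sym (+-assoc 1# _ _))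

  fromℕ-C-vanish : ∀ {k j} x → k < j → fromℕ R (k C j) * x ≈ 0#
  fromℕ-C-vanish x k<j = trans (*-congʳ (reflexive (≡.cong (fromℕ R) (k>n⇒nCk≡0 k<j)))) (zeroˡ x)

  coeff-addP : ∀ p q k → coeff R (addP R p q) k ≈ coeff R p k + coeff R q k
  coeff-addP [] q k = sym (+-identityˡ _)
  coeff-addP (a ∷ p) [] k = sym (+-identityʳ _)
  coeff-addP (a ∷ p) (b ∷ q) zero = refl
  coeff-addP (a ∷ p) (b ∷ q) (suc k) = coeff-addP p q k

  coeff-mulP-linear : ∀ p b d k →
    coeff R (mulP R p (b ∷ d ∷ [])) k ≈ coeff R p k * b + shift (coeff R p) k * d
  coeff-mulP-linear [] b d zero = sym (trans (+-cong (zeroˡ b) (zeroˡ d)) (+-identityʳ 0#))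
  coeff-mulP-linear [] b d (suc k) = sym (trans (+-cong (zeroˡ b) (zeroˡ d)) (+-identityʳ 0#))
  coeff-mulP-linear (a ∷ p) b d zero = +-congˡ (sym (zeroˡ d))
  coeff-mulP-linear (a ∷ p) b d (suc k) =
    trans (coeff-addP (a * d ∷ []) (mulP R p (b ∷ d ∷ [])) k) (tail k)
    where
    tail : ∀ k → coeff R (a * d ∷ []) k + coeff R (mulP R p (b ∷ d ∷ [])) k
                   ≈ coeff R p k * b + coeff R (a ∷ p) k * d
    tail zero = trans (+-congˡ (trans (coeff-mulP-linear p b d zero)
                                      (trans (+-congˡ (zeroˡ d)) (+-identityʳ _))))
                      (+-comm _ _)
    tail (suc k) = trans (+-identityˡ _) (coeff-mulP-linear p b d (suc k))

  sumTo-cong : ∀ n {f g : ℕ → Carrier} → (∀ k → f k ≈ g k) → sumTo R n f ≈ sumTo R n g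
  sumTo-cong zero f≈g = f≈g 0
  sumTo-cong (suc n) f≈g = +-cong (sumTo-cong n f≈g) (f≈g (suc n))

  sumTo-+ : ∀ n (f g : ℕ → Carrier) → sumTo R n (λ k → f k + g k) ≈ sumTo R n f + sumTo R n g
  sumTo-+ zero f g = refl
  sumTo-+ (suc n) f g = trans (+-congʳ (sumTo-+ n f g)) (+-interchange _ _ _ _)

  *-distribˡ-sumTo : ∀ n a (f : ℕ → Carrier) → sumTo R n (λ k → a * f k) ≈ a * sumTo R n f
  *-distribˡ-sumTo zero a f = refl
  *-distribˡ-sumTo (suc n) a f = trans (+-congʳ (*-distribˡ-sumTo n a f)) (sym (distribˡ a _ _))

  sumTo-unfoldˡ : ∀ n (f : ℕ → Carrier) → sumTo R (suc n) f ≈ f 0 + sumTo R n (λ k → f (suc k))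
  sumTo-unfoldˡ zero f = refl
  sumTo-unfoldˡ (suc n) f = trans (+-congʳ (sumTo-unfoldˡ n f)) (+-assoc _ _ _)

  sumTo-zero : ∀ n (f : ℕ → Carrier) → (∀ k → k ≤ n → f k ≈ 0#) → sumTo R n f ≈ 0#
  sumTo-zero zero f f≈0 = f≈0 0 z≤n
  sumTo-zero (suc n) f f≈0 =
    trans (+-cong (sumTo-zero n f (λ k k≤n → f≈0 k (ℕ.m≤n⇒m≤1+n k≤n))) (f≈0 (suc n) ℕ.≤-refl))
          (+-identityʳ 0#)

  sumTo-dropPrefix : ∀ i d (f : ℕ → Carrier) → (∀ k → k < i → f k ≈ 0#) →
    sumTo R (i +ℕ d) f ≈ sumTo R d (λ m → f (i +ℕ m))
  sumTo-dropPrefix zero d f _ = refl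
  sumTo-dropPrefix (suc i) d f f≈0 = begin
    sumTo R (suc i +ℕ d) f                          ≈⟨ sumTo-unfoldˡ (i +ℕ d) f ⟩
    f 0 + sumTo R (i +ℕ d) (λ k → f (suc k))        ≈⟨ +-congʳ (f≈0 0 (s≤s z≤n)) ⟩
    0# + sumTo R (i +ℕ d) (λ k → f (suc k))         ≈⟨ +-identityˡ _ ⟩
    sumTo R (i +ℕ d) (λ k → f (suc k))
      ≈⟨ sumTo-dropPrefix i d (λ k → f (suc k)) (λ k k<i → f≈0 (suc k) (s≤s k<i)) ⟩
    sumTo R d (λ m → f (suc i +ℕ m))                ∎

  sumFromTo-≤ : ∀ {i n} (f : ℕ → Carrier) → i ≤ n →
    sumFromTo R i n f ≡ sumTo R (n ∸ i) (λ m → f (i +ℕ m))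
  sumFromTo-≤ {i} {n} f i≤n =
    ≡.cong (λ b → if b then sumTo R (n ∸ i) (λ m → f (i +ℕ m)) else 0#) (dec-true (i ≤? n) i≤n)

  sumFromTo-> : ∀ {i n} (f : ℕ → Carrier) → n < i → sumFromTo R i n f ≡ 0#
  sumFromTo-> {i} {n} f n<i =
    ≡.cong (λ b → if b then sumTo R (n ∸ i) (λ m → f (i +ℕ m)) else 0#)
           (dec-false (i ≤? n) (ℕ.<⇒≱ n<i))

  sumTo≈sumFromTo : ∀ i n (f : ℕ → Carrier) → (∀ k → k < i → f k ≈ 0#) →
    sumTo R n f ≈ sumFromTo R i n f
  sumTo≈sumFromTo i n f f≈0 with i ≤? n
  ... | yes i≤n = begin
    sumTo R n f                             ≡⟨ ≡.cong (λ m → sumTo R m f) (ℕ.m+[n∸m]≡n i≤n) ⟨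
    sumTo R (i +ℕ (n ∸ i)) f                ≈⟨ sumTo-dropPrefix i (n ∸ i) f f≈0 ⟩
    sumTo R (n ∸ i) (λ m → f (i +ℕ m))      ≡⟨ sumFromTo-≤ f i≤n ⟨
    sumFromTo R i n f                       ∎
  ... | no i≰n = begin
    sumTo R n f        ≈⟨ sumTo-zero n f (λ k k≤n → f≈0 k (ℕ.≤-<-trans k≤n (ℕ.≰⇒> i≰n))) ⟩
    0#                 ≡⟨ sumFromTo-> f (ℕ.≰⇒> i≰n) ⟨
    sumFromTo R i n f  ∎

  sumFromTo-unfoldˡ : ∀ i n (f : ℕ → Carrier) → (n < i → f i ≈ 0#) →
    sumFromTo R i n f ≈ f i + sumFromTo R (suc i) n f
  sumFromTo-unfoldˡ i n f f≈0 with ℕ.<-cmp i n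
  ... | tri< i<n _ _ = begin
    sumFromTo R i n f                                        ≡⟨ sumFromTo-≤ f (ℕ.<⇒≤ i<n) ⟩
    sumTo R (n ∸ i) (λ m → f (i +ℕ m))
      ≡⟨ ≡.cong (λ d → sumTo R d (λ m → f (i +ℕ m))) (ℕ.+-∸-assoc 1 i<n) ⟩
    sumTo R (suc (n ∸ suc i)) (λ m → f (i +ℕ m))
      ≈⟨ sumTo-unfoldˡ (n ∸ suc i) (λ m → f (i +ℕ m)) ⟩
    f (i +ℕ 0) + sumTo R (n ∸ suc i) (λ m → f (i +ℕ suc m))
      ≈⟨ +-cong (reflexive (≡.cong f (ℕ.+-identityʳ i)))
                (sumTo-cong (n ∸ suc i) (λ m → reflexive (≡.cong f (ℕ.+-suc i m)))) ⟩
    f i + sumTo R (n ∸ suc i) (λ m → f (suc i +ℕ m))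
      ≡⟨ ≡.cong (f i +_) (sumFromTo-≤ f i<n) ⟨
    f i + sumFromTo R (suc i) n f
      ∎
  ... | tri≈ _ ≡.refl _ = begin
    sumFromTo R i i f                            ≡⟨ sumFromTo-≤ {i} f ℕ.≤-refl ⟩
    sumTo R (i ∸ i) (λ m → f (i +ℕ m))
      ≡⟨ ≡.cong (λ d → sumTo R d (λ m → f (i +ℕ m))) (ℕ.n∸n≡0 i) ⟩
    f (i +ℕ 0)                                   ≡⟨ ≡.cong f (ℕ.+-identityʳ i) ⟩
    f i                                          ≈⟨ +-identityʳ (f i) ⟨
    f i + 0#                                     ≡⟨ ≡.cong (f i +_) (sumFromTo-> f (ℕ.n<1+n i)) ⟨
    f i + sumFromTo R (suc i) i f                ∎
  ... | tri> _ _ n<i = begin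
    sumFromTo R i n f                 ≡⟨ sumFromTo-> f n<i ⟩
    0#                                ≈⟨ f≈0 n<i ⟨
    f i                               ≈⟨ +-identityʳ (f i) ⟨
    f i + 0#                          ≡⟨ ≡.cong (f i +_) (sumFromTo-> f (ℕ.m<n⇒m<1+n n<i)) ⟨
    f i + sumFromTo R (suc i) n f     ∎

  module _ (lam : Carrier) where

    S : ℕ → ℕ → Carrier
    S = stirling1 R lam

    stirling1-suc : ∀ n k → S (suc n) k ≈ S n k * (fromℕ R n * lam) + shift (S n) k
    stirling1-suc n k = trans (coeff-mulP-linear (risingFact R lam n) _ 1# k) (+-congˡ (*-identityʳ _))

    stirling1-vanish : ∀ {n k} → n < k → S n k ≈ 0#
    stirling1-vanish {zero} {suc k} _ = refl
    stirling1-vanish {suc n} {suc k} (s≤s n<k) = begin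
      S (suc n) (suc k)                         ≈⟨ stirling1-suc n (suc k) ⟩
      S n (suc k) * (fromℕ R n * lam) + S n k
        ≈⟨ +-cong (trans (*-congʳ (stirling1-vanish (ℕ.m<n⇒m<1+n n<k))) (zeroˡ _))
                  (stirling1-vanish n<k) ⟩
      0# + 0#                                   ≈⟨ +-identityʳ 0# ⟩
      0#                                        ∎

    -- the coefficient of x^j in (x + λ)^k
    binomialTerm : ℕ → ℕ → Carrier
    binomialTerm k j = fromℕ R (k C j) * pow R lam (k ∸ j)

    binomialTerm-vanish : ∀ {k j} → k < j → binomialTerm k j ≈ 0#
    binomialTerm-vanish = fromℕ-C-vanish _

    binomialTerm-diag : ∀ j → binomialTerm j j ≈ 1#
    binomialTerm-diag j rewrite nCn≡1 j | ℕ.n∸n≡0 j = trans (*-identityʳ _) (+-identityʳ 1#)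

    binomialTerm-suc : ∀ k j →
      binomialTerm (suc k) j ≈ lam * binomialTerm k j + shift (binomialTerm k) j
    binomialTerm-suc k zero = trans (x∙yz≈y∙xz _ lam _) (sym (+-identityʳ _))
    binomialTerm-suc k (suc i) = begin
      fromℕ R (suc k C suc i) * pow R lam (k ∸ i)
        ≡⟨ ≡.cong (λ m → fromℕ R m * pow R lam (k ∸ i)) (nCk+nC[k+1]≡[n+1]C[k+1] k i) ⟨
      fromℕ R (k C i +ℕ k C suc i) * pow R lam (k ∸ i)
        ≈⟨ trans (*-congʳ (fromℕ-+ (k C i) (k C suc i))) (distribʳ _ _ _) ⟩
      binomialTerm k i + fromℕ R (k C suc i) * pow R lam (k ∸ i)
        ≈⟨ +-congˡ (lowerExponent k i) ⟩
      binomialTerm k i + lam * binomialTerm k (suc i)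
        ≈⟨ +-comm _ _ ⟩
      lam * binomialTerm k (suc i) + binomialTerm k i ∎
      where
      lowerExponent : ∀ k i →
        fromℕ R (k C suc i) * pow R lam (k ∸ i) ≈ lam * binomialTerm k (suc i)
      lowerExponent k i with i <? k
      ... | yes i<k rewrite ℕ.+-∸-assoc 1 i<k = x∙yz≈y∙xz _ lam _
      ... | no i≮k = trans (fromℕ-C-vanish _ k<1+i)
                           (sym (trans (*-congˡ (binomialTerm-vanish k<1+i)) (zeroʳ lam)))
        where
        k<1+i : k < suc i
        k<1+i = s≤s (ℕ.≮⇒≥ i≮k)

    -- the coefficient of x^j in ⟨x + λ⟩_{n,λ} = Σ_k [n,k]_λ (x + λ)^k
    shiftedRisingCoeff : ℕ → ℕ → Carrier
    shiftedRisingCoeff n j = sumTo R n (λ k → S n k * binomialTerm k j)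

    shiftedRisingCoeff-zero : ∀ j → shiftedRisingCoeff 0 j ≈ S 0 j
    shiftedRisingCoeff-zero zero = trans (*-identityˡ _) (binomialTerm-diag 0)
    shiftedRisingCoeff-zero (suc j) =
      trans (*-identityˡ _) (binomialTerm-vanish {0} {suc j} (s≤s z≤n))

    shiftedRisingCoeff-suc : ∀ n j →
      shiftedRisingCoeff (suc n) j
        ≈ shiftedRisingCoeff n j * (fromℕ R (suc n) * lam) + shift (shiftedRisingCoeff n) j
    shiftedRisingCoeff-suc n j = begin
      sumTo R (suc n) (λ k → S (suc n) k * b k j)
        ≈⟨ sumTo-cong (suc n) (λ k → trans (*-congʳ (stirling1-suc n k)) (distribʳ _ _ _)) ⟩
      sumTo R (suc n) (λ k → S n k * x * b k j + shift (S n) k * b k j)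
        ≈⟨ sumTo-+ (suc n) _ _ ⟩
      sumTo R (suc n) (λ k → S n k * x * b k j) + sumTo R (suc n) (λ k → shift (S n) k * b k j)
        ≈⟨ +-cong oldDegree newDegree ⟩
      x * P n j + (lam * P n j + shift (P n) j)
        ≈⟨ collect x lam (P n j) (shift (P n) j) ⟩
      P n j * (lam + x) + shift (P n) j
        ≈⟨ +-congʳ (*-congˡ (trans (+-congʳ (sym (*-identityˡ lam)))
                                   (sym (distribʳ lam 1# _)))) ⟩
      P n j * (fromℕ R (suc n) * lam) + shift (P n) j ∎
      where
      P b : ℕ → ℕ → Carrier
      P = shiftedRisingCoeff
      b = binomialTerm

      x : Carrier
      x = fromℕ R n * lam

      collect : ∀ a l p q → a * p + (l * p + q) ≈ p * (l + a) + q
      collect = solve 4 (λ a l p q → a :* p :+ (l :* p :+ q) := p :* (l :+ a) :+ q) refl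

      oldDegree : sumTo R (suc n) (λ k → S n k * x * b k j) ≈ x * P n j
      oldDegree = begin
        sumTo R n (λ k → S n k * x * b k j) + S n (suc n) * x * b (suc n) j
          ≈⟨ +-congˡ (trans (*-congʳ (trans (*-congʳ (stirling1-vanish {n} ℕ.≤-refl)) (zeroˡ x)))
                            (zeroˡ _)) ⟩
        sumTo R n (λ k → S n k * x * b k j) + 0#
          ≈⟨ +-identityʳ _ ⟩
        sumTo R n (λ k → S n k * x * b k j)
          ≈⟨ sumTo-cong n (λ k → trans (*-congʳ (*-comm _ x)) (*-assoc x _ _)) ⟩
        sumTo R n (λ k → x * (S n k * b k j))
          ≈⟨ *-distribˡ-sumTo n x _ ⟩
        x * P n j ∎

      shiftedIndex : ∀ j → sumTo R n (λ k → S n k * shift (b k) j) ≈ shift (P n) j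
      shiftedIndex zero = sumTo-zero n _ (λ k _ → zeroʳ (S n k))
      shiftedIndex (suc j) = refl

      newDegree : sumTo R (suc n) (λ k → shift (S n) k * b k j) ≈ lam * P n j + shift (P n) j
      newDegree = begin
        sumTo R (suc n) (λ k → shift (S n) k * b k j)
          ≈⟨ sumTo-unfoldˡ n _ ⟩
        0# * b 0 j + sumTo R n (λ k → S n k * b (suc k) j)
          ≈⟨ trans (+-congʳ (zeroˡ _)) (+-identityˡ _) ⟩
        sumTo R n (λ k → S n k * b (suc k) j)
          ≈⟨ sumTo-cong n (λ k → trans (*-congˡ (binomialTerm-suc k j)) (distribˡ _ _ _)) ⟩
        sumTo R n (λ k → S n k * (lam * b k j) + S n k * shift (b k) j)
          ≈⟨ sumTo-+ n _ _ ⟩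
        sumTo R n (λ k → S n k * (lam * b k j)) + sumTo R n (λ k → S n k * shift (b k) j)
          ≈⟨ +-cong (trans (sumTo-cong n (λ k → x∙yz≈y∙xz _ lam _)) (*-distribˡ-sumTo n lam _))
                    (shiftedIndex j) ⟩
        lam * P n j + shift (P n) j ∎

    stirling1-suc≈shiftedRisingCoeff : ∀ n j → S (suc n) j ≈ shift (shiftedRisingCoeff n) j
    stirling1-suc≈shiftedRisingCoeff zero j = begin
      S 1 j                                      ≈⟨ stirling1-suc 0 j ⟩
      S 0 j * (0# * lam) + shift (S 0) j
        ≈⟨ +-cong (trans (*-congˡ (zeroˡ lam)) (zeroʳ _)) (shift-initial j) ⟩
      0# + shift (shiftedRisingCoeff 0) j        ≈⟨ +-identityˡ _ ⟩
      shift (shiftedRisingCoeff 0) j             ∎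
      where
      shift-initial : ∀ j → shift (S 0) j ≈ shift (shiftedRisingCoeff 0) j
      shift-initial zero = refl
      shift-initial (suc j) = sym (shiftedRisingCoeff-zero j)
    stirling1-suc≈shiftedRisingCoeff (suc n) zero = begin
      S (suc (suc n)) 0                                      ≈⟨ stirling1-suc (suc n) 0 ⟩
      S (suc n) 0 * (fromℕ R (suc n) * lam) + 0#             ≈⟨ +-identityʳ _ ⟩
      S (suc n) 0 * (fromℕ R (suc n) * lam)
        ≈⟨ trans (*-congʳ (stirling1-suc≈shiftedRisingCoeff n 0)) (zeroˡ _) ⟩
      0#                                                     ∎
    stirling1-suc≈shiftedRisingCoeff (suc n) (suc j) = begin
      S (suc (suc n)) (suc j)                                ≈⟨ stirling1-suc (suc n) (suc j) ⟩
      S (suc n) (suc j) * (fromℕ R (suc n) * lam) + S (suc n) j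
        ≈⟨ +-cong (*-congʳ (stirling1-suc≈shiftedRisingCoeff n (suc j)))
                  (stirling1-suc≈shiftedRisingCoeff n j) ⟩
      shiftedRisingCoeff n j * (fromℕ R (suc n) * lam) + shift (shiftedRisingCoeff n) j
        ≈⟨ shiftedRisingCoeff-suc n j ⟨
      shiftedRisingCoeff (suc n) j                           ∎

theorem4 : {c ℓ : Level} (R : CommutativeRing c ℓ) → let open CommutativeRing R in
    (lam : Carrier) (n j : ℕ) → 1 ≤ j →
    (stirling1 R lam (suc n) j
    ≈ sumFromTo R (j ∸ 1) n (λ k → stirling1 R lam n k * fromℕ R (k C (j ∸ 1)) * pow R lam ((k +ℕ 1) ∸ j)))
    × (sumFromTo R (j ∸ 1) n (λ k → stirling1 R lam n k * fromℕ R (k C (j ∸ 1)) * pow R lam ((k +ℕ 1) ∸ j))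
    ≈ stirling1 R lam n (j ∸ 1) + sumFromTo R j n (λ k → stirling1 R lam n k * fromℕ R (k C (j ∸ 1)) * pow R lam ((k +ℕ 1) ∸ j)))
theorem4 R lam n (suc i) _ = sumTo-form , split-first
  where
  open CommutativeRing R
  open SetoidReasoning setoid

  term : ℕ → Carrier
  term k = stirling1 R lam n k * fromℕ R (k C i) * pow R lam ((k +ℕ 1) ∸ suc i)

  term≈ : ∀ k → term k ≈ S R lam n k * binomialTerm R lam k i
  term≈ k = trans (*-assoc _ _ _) (*-congˡ (*-congˡ (reflexive exponent)))
    where
    exponent : pow R lam ((k +ℕ 1) ∸ suc i) ≡ pow R lam (k ∸ i)
    exponent = ≡.cong (λ m → pow R lam (m ∸ suc i)) (ℕ.+-comm k 1)

  sumTo-form : stirling1 R lam (suc n) (suc i) ≈ sumFromTo R i n term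
  sumTo-form = begin
    stirling1 R lam (suc n) (suc i)   ≈⟨ stirling1-suc≈shiftedRisingCoeff R lam n (suc i) ⟩
    shiftedRisingCoeff R lam n i      ≈⟨ sumTo-cong R n term≈ ⟨
    sumTo R n term
      ≈⟨ sumTo≈sumFromTo R i n term
           (λ k k<i → trans (term≈ k) (trans (*-congˡ (binomialTerm-vanish R lam k<i)) (zeroʳ _))) ⟩
    sumFromTo R i n term              ∎

  split-first : sumFromTo R i n term ≈ stirling1 R lam n i + sumFromTo R (suc i) n term
  split-first = begin
    sumFromTo R i n term
      ≈⟨ sumFromTo-unfoldˡ R i n term
           (λ n<i → trans (term≈ i) (trans (*-congʳ (stirling1-vanish R lam n<i)) (zeroˡ _))) ⟩
    term i + sumFromTo R (suc i) n term
      ≈⟨ +-congʳ (trans (term≈ i) (trans (*-congˡ (binomialTerm-diag R lam i))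
                                          (*-identityʳ _))) ⟩
    stirling1 R lam n i + sumFromTo R (suc i) n term ∎
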